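{- For every integer $k\geq 1$, let $G_k$ be the graph with vertex set $[k+2]\times[3k+6]$ and edge set $\{\{(x,y),(x+1,y)\} : x\in[k+1],\ y\in[3k+6]\}\cup\{\{(x,y),(x,y+1)\} : x\in[k],\ y\in[3k+5]\}$. Then the pathwidth of $G_k$ equals $k+1$.
   Context: For an integer $n\ge 1$, $[n]=\{1,2,\dots,n\}$. Pathwidth is the minimum width (maximum bag size minus one) over all path decompositions of the graph. -}

module Defs where

open import Data.Nat using (ℕ; suc; _≤_; _<_; _⊔_; _∸_; _+_; _*_)
open import Data.Fin using (Fin; toℕ)
open import Data.List using (List; length; foldr; map)
open import Data.List.Membership.Propositional using (_∈_)
open import Data.List.Relation.Unary.Unique.Propositional using (Unique)
open import Data.Vec.Functional using (Vector)
open import Data.Product using (Σ; _×_; _,_)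
open import Data.Sum using (_⊎_)
open import Relation.Binary.PropositionalEquality using (_≡_)
import Data.Vec.Functional as VF

-- A (simple, undirected) graph on vertex type V given by an adjacency relation.
-- Only whether {u,v} is an edge matters; the conditions below are symmetric in u v.
record Graph : Set₁ where
  field
    V   : Set
    Adj : V → V → Set

-- A path decomposition: a sequence of m bags B₀,…,B_{m-1}, each a duplicate-free
-- list of vertices (so its length is its cardinality), such that
--  * every vertex lies in some bag,
--  * both ends of every edge lie in a common bag,
--  * for each vertex, the bags containing it are consecutive.
record PathDecomposition (G : Graph) : Set where
  open Graph G
  field
    m        : ℕ
    bag      : Fin m → List V
    unique   : ∀ i → Unique (bag i)
    covers   : ∀ v → Σ (Fin m) λ i → v ∈ bag i
    edgeIn   : ∀ u v → Adj u v → Σ (Fin m) λ i → (u ∈ bag i) × (v ∈ bag i)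
    interval : ∀ v (i j l : Fin m) → toℕ i ≤ toℕ j → toℕ j ≤ toℕ l →
               v ∈ bag i → v ∈ bag l → v ∈ bag j

width : ∀ {G} → PathDecomposition G → ℕ
width pd = VF.foldr (λ b acc → length b ⊔ acc) 0 bag ∸ 1
  where open PathDecomposition pd

HasPathwidth : Graph → ℕ → Set
HasPathwidth G w = (Σ (PathDecomposition G) λ pd → width pd ≡ w)
                 × (∀ (pd : PathDecomposition G) → w ≤ width pd)

-- G_k with vertex set [k+2] × [3k+6], written 0-indexed as Fin (k+2) × Fin (3k+6):
-- paper vertex (x,y) corresponds to (x-1, y-1).
GkAdj : (k : ℕ) → Fin (k + 2) × Fin (3 * k + 6) → Fin (k + 2) × Fin (3 * k + 6) → Set
GkAdj k (x , y) (x' , y') =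
    (toℕ x' ≡ suc (toℕ x) × y ≡ y')
  ⊎ (x ≡ x' × toℕ y' ≡ suc (toℕ y) × toℕ x < k)

Gk : ℕ → Graph
Gk k = record { V = Fin (k + 2) × Fin (3 * k + 6) ; Adj = GkAdj k }

-- Columns 0 … k-1 of G_k are inner (they carry the vertical edges); columns k and k+1 are
-- pendant, and each row is a path through all k+2 columns.
--
-- Upper bound: read bag indices in base K = k+1. Inner vertex (x,y) lives on the bags
-- x + yK … x + (y+1)K, and both pendants of row y only on bag k + yK, the one residue at
-- which no inner interval starts. So every bag holds at most k+2 vertices.
--
-- Lower bound: suppose every bag has at most k+1 vertices. Let T be the first bag such that
-- some inner column x₀ lies entirely in bags ≤ T, and S the last bag such that some inner
-- column x₁ lies entirely in bags ≥ S. By these choices every inner column has a vertex in a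
-- bag ≤ S and one in a bag ≥ T; being a path, it meets every bag between S and T. A bag
-- between S and T holding a pendant edge {(k,y),(k+1,y)} would then hold k+2 vertices. If
-- that bag is before S, the row from (k,y) to (x₁,y) meets bag S; if it is after T, the row
-- from (x₀,y) to (k,y) meets bag T. Hence bags S and T together meet all 3k+6 rows, but
-- they hold at most 2k+2 vertices.
{-# OPTIONS --safe #-}
module Submission where

open import Defs
open import Data.Nat
  using (ℕ; zero; suc; _≤_; _<_; _+_; _*_; _∸_; _⊔_; z≤n; s≤s; _≤?_; _<?_; NonZero)
open import Data.Nat.Properties
open import Data.Nat.Tactic.RingSolver using (solve-∀)
open import Data.Nat.DivMod using (_%_; [m+kn]%n≡m%n; m<n⇒m%n≡m)
open import Data.Fin as Fin using (Fin; toℕ; fromℕ<)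
import Data.Fin.Properties as Fin
open import Data.List.Properties using (length-++)
open import Data.List using (List; length; lookup; filter; _++_; cartesianProduct; allFin)
open import Data.List.Membership.Propositional using (_∈_)
open import Data.List.Membership.Propositional.Properties
  using (∈-lookup; ∈-filter⁺; ∈-filter⁻; ∈-cartesianProduct⁺; ∈-allFin; ∈-++⁺ˡ; ∈-++⁺ʳ)
open import Data.List.Relation.Unary.Any using (index)
open import Data.List.Relation.Unary.Any.Properties using (lookup-index)
import Data.List.Relation.Unary.All as All
open import Data.List.Relation.Unary.AllPairs using (_∷_)
open import Data.List.Relation.Unary.Unique.Propositional using (Unique)
import Data.List.Relation.Unary.Unique.Propositional.Properties as Unique
open import Data.Product using (∃; _×_; _,_; proj₁; proj₂)
open import Data.Product.Properties using (≡-dec)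
open import Data.Sum using (_⊎_; inj₁; inj₂)
open import Data.Empty using (⊥; ⊥-elim)
open import Function using (_∘_)
open import Relation.Nullary using (¬_; Dec; yes; no)
open import Relation.Nullary.Decidable using (_×-dec_; ¬?; decidable-stable)
open import Relation.Unary using (Decidable)
open import Relation.Binary.Definitions using (DecidableEquality)
open import Relation.Binary.PropositionalEquality
import Data.Vec.Functional as Vector

lookup-injective : ∀ {A : Set} {xs : List A} → Unique xs →
                   ∀ i j → lookup xs i ≡ lookup xs j → i ≡ j
lookup-injective (_ ∷ _) Fin.zero Fin.zero _ = refl
lookup-injective (x∉xs ∷ _) Fin.zero (Fin.suc j) eq = ⊥-elim (All.lookup x∉xs (∈-lookup j) eq)
lookup-injective (x∉xs ∷ _) (Fin.suc i) Fin.zero eq = ⊥-elim (All.lookup x∉xs (∈-lookup i) (sym eq))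
lookup-injective (_ ∷ xs!) (Fin.suc i) (Fin.suc j) eq = cong Fin.suc (lookup-injective xs! i j eq)

injectiveOn⇒length≤ : ∀ {A : Set} {xs : List A} {N} → Unique xs → (f : A → ℕ) →
                      (∀ {x} → x ∈ xs → f x < N) →
                      (∀ {x y} → x ∈ xs → y ∈ xs → f x ≡ f y → x ≡ y) →
                      length xs ≤ N
injectiveOn⇒length≤ {xs = xs} xs! f f< f-inj = Fin.injective⇒≤ {f = code} code-injective
  where
  code : Fin (length xs) → Fin _
  code i = fromℕ< (f< (∈-lookup i))

  code-injective : ∀ {i j} → code i ≡ code j → i ≡ j
  code-injective {i} {j} eq = lookup-injective xs! i j
    (f-inj (∈-lookup i) (∈-lookup j) (Fin.fromℕ<-injective _ _ _ _ eq))

surjectiveOn⇒≤length : ∀ {A : Set} {xs : List A} {n} (g : A → Fin n) →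
                       (∀ j → ∃ λ x → g x ≡ j × x ∈ xs) → n ≤ length xs
surjectiveOn⇒≤length {xs = xs} g g-onto = Fin.injective⇒≤ {f = position} position-injective
  where
  preimage : Fin _ → _
  preimage j = proj₁ (g-onto j)

  g∘preimage : ∀ j → g (preimage j) ≡ j
  g∘preimage j = proj₁ (proj₂ (g-onto j))

  preimage∈ : ∀ j → preimage j ∈ xs
  preimage∈ j = proj₂ (proj₂ (g-onto j))

  position : Fin _ → Fin (length xs)
  position j = index (preimage∈ j)

  position-injective : ∀ {i j} → position i ≡ position j → i ≡ j
  position-injective {i} {j} eq = begin
    i                           ≡⟨ sym (g∘preimage i) ⟩
    g (preimage i)              ≡⟨ cong g (lookup-index (preimage∈ i)) ⟩
    g (lookup xs (position i))  ≡⟨ cong (g ∘ lookup xs) eq ⟩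
    g (lookup xs (position j))  ≡⟨ cong g (sym (lookup-index (preimage∈ j))) ⟩
    g (preimage j)              ≡⟨ g∘preimage j ⟩
    j                           ∎
    where open ≡-Reasoning

quotRem-injective : ∀ d .{{_ : NonZero d}} {q q′ r r′} → r < d → r′ < d →
                    r + q * d ≡ r′ + q′ * d → r ≡ r′ × q ≡ q′
quotRem-injective d {q} {q′} {r} {r′} r<d r′<d eq = r≡r′ , q≡q′
  where
  open ≡-Reasoning
  r≡r′ : r ≡ r′
  r≡r′ = begin
    r                  ≡⟨ sym (m<n⇒m%n≡m r<d) ⟩
    r % d              ≡⟨ sym ([m+kn]%n≡m%n r q d) ⟩
    (r + q * d) % d    ≡⟨ cong (_% d) eq ⟩
    (r′ + q′ * d) % d  ≡⟨ [m+kn]%n≡m%n r′ q′ d ⟩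
    r′ % d             ≡⟨ m<n⇒m%n≡m r′<d ⟩
    r′                 ∎
  q≡q′ : q ≡ q′
  q≡q′ = *-cancelʳ-≡ q q′ d (+-cancelˡ-≡ r _ _ (trans eq (cong (_+ q′ * d) (sym r≡r′))))

transition : ∀ {m} {P : ℕ → Set} → Decidable P → ¬ P 0 → P m →
             ∃ λ (t : Fin m) → ¬ P (toℕ t) × P (suc (toℕ t))
transition {zero} _ ¬P0 Pm = ⊥-elim (¬P0 Pm)
transition {suc m} P? ¬P0 Pm with P? 1
... | yes P1 = Fin.zero , ¬P0 , P1
... | no ¬P1 = let t , ¬Pt , Pt+1 = transition {m} (P? ∘ suc) ¬P1 Pm in Fin.suc t , ¬Pt , Pt+1

maxLength : ∀ {A : Set} {n} → (Fin n → List A) → ℕ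
maxLength = Vector.foldr (λ b acc → length b ⊔ acc) 0

length≤maxLength : ∀ {A : Set} {n} (bs : Fin n → List A) i → length (bs i) ≤ maxLength bs
length≤maxLength bs Fin.zero = m≤m⊔n _ _
length≤maxLength bs (Fin.suc i) = ≤-trans (length≤maxLength (bs ∘ Fin.suc) i) (m≤n⊔m _ _)

maxLength≤ : ∀ {A : Set} {n} (bs : Fin n → List A) {b} →
             (∀ i → length (bs i) ≤ b) → maxLength bs ≤ b
maxLength≤ {n = zero} bs _ = z≤n
maxLength≤ {n = suc n} bs bs≤ = ⊔-lub (bs≤ Fin.zero) (maxLength≤ (bs ∘ Fin.suc) (bs≤ ∘ Fin.suc))

module _ {G : Graph} (pd : PathDecomposition G) where
  open PathDecomposition pd

  length-bag≤1+width : ∀ i → length (bag i) ≤ suc (width pd)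
  length-bag≤1+width i = ≤-trans (length≤maxLength bag i) (m≤n+m∸n (maxLength bag) 1)

  width≤ : ∀ {w} → (∀ i → length (bag i) ≤ suc w) → width pd ≤ w
  width≤ bag≤ = ∸-monoˡ-≤ 1 (maxLength≤ bag bag≤)

module Walks (G : Graph) where
  open Graph G

  Edge : V → V → Set
  Edge u v = Adj u v ⊎ Adj v u

  data WalkIn (P : V → Set) : V → V → Set where
    [_]  : ∀ {u} → P u → WalkIn P u u
    step : ∀ {u v w} → P u → Edge u v → WalkIn P v w → WalkIn P u w

  snoc : ∀ {P u v w} → WalkIn P u v → Edge v w → P w → WalkIn P u w
  snoc [ Pu ] e Pw = step Pu e [ Pw ]
  snoc (step Pu e walk) e′ Pw = step Pu e (snoc walk e′ Pw)

  record Line (P : V → Set) (N : ℕ) : Set where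
    field
      point : Fin N → V
      inside : ∀ a → P (point a)
      adjacent : ∀ a b → toℕ b ≡ suc (toℕ a) → Adj (point a) (point b)

  open Line

  dropFirst : ∀ {P N} → Line P (suc N) → Line P N
  dropFirst L = record
    { point = point L ∘ Fin.suc
    ; inside = inside L ∘ Fin.suc
    ; adjacent = λ a b → adjacent L (Fin.suc a) (Fin.suc b) ∘ cong suc
    }

  lineWalk : ∀ {P N} (L : Line P N) a b → WalkIn P (point L a) (point L b)
  lineWalk L Fin.zero Fin.zero = [ inside L Fin.zero ]
  lineWalk {N = suc (suc _)} L Fin.zero (Fin.suc b) =
    step (inside L Fin.zero) (inj₁ (adjacent L Fin.zero (Fin.suc Fin.zero) refl))
      (lineWalk (dropFirst L) Fin.zero b)
  lineWalk {N = suc (suc _)} L (Fin.suc a) Fin.zero =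
    snoc (lineWalk (dropFirst L) a Fin.zero)
      (inj₂ (adjacent L Fin.zero (Fin.suc Fin.zero) refl)) (inside L Fin.zero)
  lineWalk L (Fin.suc a) (Fin.suc b) = lineWalk (dropFirst L) a b

  module _ (pd : PathDecomposition G) where
    open PathDecomposition pd

    edgeIn′ : ∀ {u v} → Edge u v → ∃ λ i → u ∈ bag i × v ∈ bag i
    edgeIn′ (inj₁ uv) = edgeIn _ _ uv
    edgeIn′ (inj₂ vu) = let i , v∈ , u∈ = edgeIn _ _ vu in i , u∈ , v∈

    walk-meets-bag : ∀ {P u w a b} → WalkIn P u w → u ∈ bag a → w ∈ bag b →
                     ∀ t → toℕ a ≤ toℕ t → toℕ t ≤ toℕ b → ∃ λ z → P z × z ∈ bag t
    walk-meets-bag [ Pu ] u∈a w∈b t a≤t t≤b = _ , Pu , interval _ _ t _ a≤t t≤b u∈a w∈b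
    walk-meets-bag (step Pu e walk) u∈a w∈b t a≤t t≤b with edgeIn′ e
    ... | i , u∈i , v∈i with toℕ t ≤? toℕ i
    ...   | yes t≤i = _ , Pu , interval _ _ t _ a≤t t≤i u∈a u∈i
    ...   | no  t≰i = walk-meets-bag walk v∈i w∈b t (<⇒≤ (≰⇒> t≰i)) t≤b

record IntervalModel (G : Graph) : Set where
  open Graph G
  field
    vertices        : List V
    vertices-unique : Unique vertices
    ∈-vertices      : ∀ v → v ∈ vertices
    m               : ℕ
    lo hi           : V → ℕ
    lo≤hi           : ∀ v → lo v ≤ hi v
    hi<m            : ∀ v → hi v < m
    overlaps        : ∀ u v → Adj u v →
                      ∃ λ t → (lo u ≤ t × t ≤ hi u) × (lo v ≤ t × t ≤ hi v)

  Live : V → ℕ → Set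
  Live v t = lo v ≤ t × t ≤ hi v

  live? : ∀ t → Decidable (λ v → Live v t)
  live? t v = (lo v ≤? t) ×-dec (t ≤? hi v)

  bag : Fin m → List V
  bag i = filter (live? (toℕ i)) vertices

  bag⁻ : ∀ {v i} → v ∈ bag i → Live v (toℕ i)
  bag⁻ = proj₂ ∘ ∈-filter⁻ (live? _) {xs = vertices}

  bag⁺ : ∀ {v t} (t<m : t < m) → Live v t → v ∈ bag (fromℕ< t<m)
  bag⁺ {v} t<m live =
    ∈-filter⁺ (live? _) (∈-vertices v) (subst (Live v) (sym (Fin.toℕ-fromℕ< t<m)) live)

  live⇒<m : ∀ {v t} → Live v t → t < m
  live⇒<m {v} (_ , t≤hi) = ≤-<-trans t≤hi (hi<m v)

  pathDecomposition : PathDecomposition G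
  pathDecomposition = record
    { m        = m
    ; bag      = bag
    ; unique   = λ i → Unique.filter⁺ (live? (toℕ i)) vertices-unique
    ; covers   = λ v → let live = ≤-refl , lo≤hi v in _ , bag⁺ (live⇒<m live) live
    ; edgeIn   = λ u v uv → let t , live-u , live-v = overlaps u v uv in
                   _ , bag⁺ (live⇒<m live-u) live-u , bag⁺ (live⇒<m live-u) live-v
    ; interval = λ v i j l i≤j j≤l v∈i v∈l →
                   ∈-filter⁺ (live? _) (∈-vertices v)
                     (≤-trans (proj₁ (bag⁻ v∈i)) i≤j , ≤-trans j≤l (proj₂ (bag⁻ v∈l)))
    }

  length-bag≤ : ∀ {N} (key : ℕ → V → ℕ) → (∀ {t v} → Live v t → key t v < N) →
                (∀ {t u v} → Live u t → Live v t → key t u ≡ key t v → u ≡ v) →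
                ∀ i → length (bag i) ≤ N
  length-bag≤ key key< key-injective i =
    injectiveOn⇒length≤ (Unique.filter⁺ (live? (toℕ i)) vertices-unique) (key (toℕ i))
      (key< ∘ bag⁻) (λ u∈ v∈ → key-injective (bag⁻ u∈) (bag⁻ v∈))

module Grid (k : ℕ) where
  open Walks (Gk k) public

  height : ℕ
  height = 3 * k + 6

  Vertex : Set
  Vertex = Fin (k + 2) × Fin height

  data InnerOrPendant (x : Fin (k + 2)) : Set where
    inner   : toℕ x < k → InnerOrPendant x
    pendant : k ≤ toℕ x → InnerOrPendant x

  innerOrPendant : ∀ x → InnerOrPendant x
  innerOrPendant x with toℕ x <? k
  ... | yes x<k = inner x<k
  ... | no  x≮k = pendant (≮⇒≥ x≮k)

  row : ∀ y → Line (λ v → proj₂ v ≡ y) (k + 2)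
  row y = record
    { point    = _, y
    ; inside   = λ _ → refl
    ; adjacent = λ _ _ x′≡1+x → inj₁ (x′≡1+x , refl)
    }

  column : ∀ {x} → toℕ x < k → Line (λ v → proj₁ v ≡ x) height
  column {x} x<k = record
    { point    = x ,_
    ; inside   = λ _ → refl
    ; adjacent = λ _ _ y′≡1+y → inj₂ (refl , y′≡1+y , x<k)
    }

  toℕ≤1+k : ∀ (x : Fin (k + 2)) → toℕ x ≤ suc k
  toℕ≤1+k x = ≤-pred (≤-trans (Fin.toℕ<n x) (≤-reflexive (+-comm k 2)))

  pendant₀ pendant₁ : Fin (k + 2)
  pendant₀ = fromℕ< (m<m+n k (s≤s z≤n))
  pendant₁ = fromℕ< (≤-reflexive (+-comm 2 k))

  pendant-edge : ∀ y → GkAdj k (pendant₀ , y) (pendant₁ , y)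
  pendant-edge y = inj₁ (trans (Fin.toℕ-fromℕ< _) (cong suc (sym (Fin.toℕ-fromℕ< _))) , refl)

  pendant-cases : ∀ {x} → k ≤ toℕ x → x ≡ pendant₀ ⊎ x ≡ pendant₁
  pendant-cases {x} k≤x with toℕ x ≟ k
  ... | yes x≡k = inj₁ (Fin.toℕ-injective (trans x≡k (sym (Fin.toℕ-fromℕ< _))))
  ... | no  x≢k = inj₂ (Fin.toℕ-injective (trans x≡1+k (sym (Fin.toℕ-fromℕ< _))))
    where
    x≡1+k : toℕ x ≡ suc k
    x≡1+k = ≤-antisym (toℕ≤1+k x) (≤∧≢⇒< k≤x (x≢k ∘ sym))

  two-bags<height : suc k + suc k < height
  two-bags<height = begin-strict
    suc k + suc k              <⟨ m<m+n _ (s≤s z≤n) ⟩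
    suc k + suc k + (4 + k)    ≡⟨ rearrange k ⟩
    3 * k + 6                  ∎
    where
    open ≤-Reasoning
    rearrange : ∀ k → suc k + suc k + (4 + k) ≡ 3 * k + 6
    rearrange = solve-∀

module Sweep (k : ℕ) where
  open Grid k

  K : ℕ
  K = suc k

  offset rise lift : Fin (k + 2) → ℕ
  offset x with innerOrPendant x
  ... | inner _   = toℕ x
  ... | pendant _ = k
  rise x with innerOrPendant x
  ... | inner _   = 1
  ... | pendant _ = 0
  lift x with innerOrPendant x
  ... | inner _   = 1
  ... | pendant _ = toℕ x ∸ k

  -- Every vertex live at t gets a slot in [t, t + K], and these slots are distinct: inner
  -- slots have residue below k modulo K, pendant slots have residue k, and the two pendants
  -- live at t belong to one row and get slots K apart. So at most k + 2 vertices are live at t.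
  lo hi slot : Vertex → ℕ
  lo (x , y)   = offset x + toℕ y * K
  hi (x , y)   = offset x + (rise x + toℕ y) * K
  slot (x , y) = offset x + (lift x + toℕ y) * K

  Live : Vertex → ℕ → Set
  Live v t = lo v ≤ t × t ≤ hi v

  offset-step : ∀ {x x′} → toℕ x′ ≡ suc (toℕ x) →
                offset x ≤ offset x′ × offset x′ ≤ offset x + rise x * K
  offset-step {x} {x′} x′≡1+x with innerOrPendant x | innerOrPendant x′
  ... | inner _     | inner _    =
    ≤-trans (n≤1+n _) (≤-reflexive (sym x′≡1+x)) ,
    ≤-trans (≤-reflexive (trans x′≡1+x (+-comm 1 _))) (+-monoʳ-≤ _ (s≤s z≤n))
  ... | inner x<k   | pendant _  =
    <⇒≤ x<k , ≤-trans (n≤1+n k) (≤-trans (m≤m+n K 0) (m≤n+m _ (toℕ x)))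
  ... | pendant _   | pendant _  = ≤-refl , m≤m+n k _
  ... | pendant k≤x | inner x′<k =
    ⊥-elim (<⇒≱ x′<k (≤-trans k≤x (≤-trans (n≤1+n _) (≤-reflexive (sym x′≡1+x)))))

  rise≤lift : ∀ x → rise x ≤ lift x
  rise≤lift x with innerOrPendant x
  ... | inner _   = ≤-refl
  ... | pendant _ = z≤n

  lift≤1 : ∀ x → lift x ≤ 1
  lift≤1 x with innerOrPendant x
  ... | inner _   = ≤-refl
  ... | pendant _ = m≤n+o⇒m∸n≤o (toℕ x) k (≤-trans (toℕ≤1+k x) (≤-reflexive (+-comm 1 k)))

  hi-split : ∀ x y → hi (x , y) ≡ offset x + rise x * K + toℕ y * K
  hi-split x y = trans (cong (offset x +_) (*-distribʳ-+ K (rise x) (toℕ y)))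
                       (sym (+-assoc (offset x) _ _))

  lo≤hi : ∀ v → lo v ≤ hi v
  lo≤hi (x , y) = +-monoʳ-≤ (offset x) (*-monoˡ-≤ K (m≤n+m (toℕ y) (rise x)))

  hi<m : ∀ v → hi v < k + height * K
  hi<m (x , y) with innerOrPendant x
  ... | inner x<k = +-mono-<-≤ x<k (*-monoˡ-≤ K (Fin.toℕ<n y))
  ... | pendant _ = +-monoʳ-< k (*-monoˡ-< K (Fin.toℕ<n y))

  lo-next-row : ∀ {x y y′} → toℕ x < k → toℕ y′ ≡ suc (toℕ y) → lo (x , y′) ≡ hi (x , y)
  lo-next-row {x} x<k y′≡1+y with innerOrPendant x
  ... | inner _     = cong (λ q → toℕ x + q * K) y′≡1+y
  ... | pendant k≤x = ⊥-elim (<⇒≱ x<k k≤x)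

  overlaps : ∀ u v → GkAdj k u v → ∃ λ t → Live u t × Live v t
  overlaps (x , y) (x′ , _) (inj₁ (x′≡1+x , refl)) =
    lo (x′ , y) , (+-monoˡ-≤ _ lo≤ , ≤-trans (+-monoˡ-≤ _ ≤hi) (≤-reflexive (sym (hi-split x y))))
                , (≤-refl , lo≤hi _)
    where
    lo≤ = proj₁ (offset-step x′≡1+x)
    ≤hi = proj₂ (offset-step x′≡1+x)
  overlaps (x , y) (_ , y′) (inj₂ (refl , y′≡1+y , x<k)) =
    lo (x , y′) , (+-monoʳ-≤ (offset x) (*-monoˡ-≤ K y≤y′) , ≤-reflexive (lo-next-row x<k y′≡1+y))
                , (≤-refl , lo≤hi _)
    where
    y≤y′ : toℕ y ≤ toℕ y′
    y≤y′ = ≤-trans (n≤1+n _) (≤-reflexive (sym y′≡1+y))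

  hi≤slot : ∀ v → hi v ≤ slot v
  hi≤slot (x , y) = +-monoʳ-≤ (offset x) (*-monoˡ-≤ K (+-monoˡ-≤ (toℕ y) (rise≤lift x)))

  slot≤lo+K : ∀ v → slot v ≤ lo v + K
  slot≤lo+K (x , y) = begin
    offset x + (lift x + toℕ y) * K  ≤⟨ +-monoʳ-≤ _ (*-monoˡ-≤ K (+-monoˡ-≤ _ (lift≤1 x))) ⟩
    offset x + (K + toℕ y * K)       ≡⟨ cong (offset x +_) (+-comm K _) ⟩
    offset x + (toℕ y * K + K)       ≡⟨ sym (+-assoc (offset x) _ K) ⟩
    offset x + toℕ y * K + K         ∎
    where open ≤-Reasoning

  inner≢pendant-position : ∀ {a} q q′ → a < k → a + q * K ≢ k + q′ * K
  inner≢pendant-position q q′ a<k eq =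
    <⇒≢ a<k (proj₁ (quotRem-injective K {q} {q′} (m≤n⇒m≤1+n a<k) ≤-refl eq))

  slot-injective : ∀ {t u v} → Live u t → Live v t → slot u ≡ slot v → u ≡ v
  slot-injective {t} {x , y} {x′ , y′} (lo≤t , t≤hi) (lo′≤t , t≤hi′) eq
    with innerOrPendant x | innerOrPendant x′
  ... | inner x<k | inner x′<k =
    let x≡x′ , 1+y≡1+y′ = quotRem-injective K (m≤n⇒m≤1+n x<k) (m≤n⇒m≤1+n x′<k) eq
    in cong₂ _,_ (Fin.toℕ-injective x≡x′) (Fin.toℕ-injective (suc-injective 1+y≡1+y′))
  ... | inner x<k | pendant _ =
    ⊥-elim (inner≢pendant-position (suc (toℕ y)) (toℕ x′ ∸ k + toℕ y′) x<k eq)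
  ... | pendant _ | inner x′<k =
    ⊥-elim (inner≢pendant-position (suc (toℕ y′)) (toℕ x ∸ k + toℕ y) x′<k (sym eq))
  ... | pendant k≤x | pendant k≤x′ =
    cong₂ _,_ (Fin.toℕ-injective x≡x′) (Fin.toℕ-injective y≡y′)
    where
    same-row : k + toℕ y * K ≡ k + toℕ y′ * K
    same-row = trans (≤-antisym lo≤t t≤hi) (≤-antisym t≤hi′ lo′≤t)

    y≡y′ : toℕ y ≡ toℕ y′
    y≡y′ = proj₂ (quotRem-injective K {toℕ y} {toℕ y′} ≤-refl ≤-refl same-row)

    x∸k≡x′∸k : toℕ x ∸ k ≡ toℕ x′ ∸ k
    x∸k≡x′∸k = +-cancelʳ-≡ (toℕ y) _ _ (trans
      (proj₂ (quotRem-injective K {toℕ x ∸ k + toℕ y} {toℕ x′ ∸ k + toℕ y′} ≤-refl ≤-refl eq))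
      (cong (toℕ x′ ∸ k +_) (sym y≡y′)))

    x≡x′ : toℕ x ≡ toℕ x′
    x≡x′ = ∸-cancelʳ-≡ k≤x k≤x′ x∸k≡x′∸k

  key : ℕ → Vertex → ℕ
  key t v = slot v ∸ t

  key< : ∀ {t v} → Live v t → key t v < suc K
  key< {t} {v} (lo≤t , _) =
    s≤s (m≤n+o⇒m∸n≤o (slot v) t (≤-trans (slot≤lo+K v) (+-monoˡ-≤ K lo≤t)))

  key-injective : ∀ {t u v} → Live u t → Live v t → key t u ≡ key t v → u ≡ v
  key-injective {u = u} {v} live-u live-v eq = slot-injective live-u live-v
    (∸-cancelʳ-≡ (≤-trans (proj₂ live-u) (hi≤slot u)) (≤-trans (proj₂ live-v) (hi≤slot v)) eq)

  model : IntervalModel (Gk k)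
  model = record
    { vertices        = cartesianProduct (allFin (k + 2)) (allFin height)
    ; vertices-unique = Unique.cartesianProduct⁺ (Unique.allFin⁺ _) (Unique.allFin⁺ _)
    ; ∈-vertices      = λ (x , y) → ∈-cartesianProduct⁺ (∈-allFin x) (∈-allFin y)
    ; m               = k + height * K
    ; lo              = lo
    ; hi              = hi
    ; lo≤hi           = lo≤hi
    ; hi<m            = hi<m
    ; overlaps        = overlaps
    }

  sweep : PathDecomposition (Gk k)
  sweep = IntervalModel.pathDecomposition model

  width-sweep≤ : width sweep ≤ k + 1
  width-sweep≤ = ≤-trans (width≤ sweep (IntervalModel.length-bag≤ model key key< key-injective))
                         (≤-reflexive (+-comm 1 k))

module NarrowDecomposition (k : ℕ) (k≥1 : 1 ≤ k) (pd : PathDecomposition (Gk k))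
                           (narrow : ∀ i → length (PathDecomposition.bag pd i) ≤ suc k) where
  open Grid k
  open PathDecomposition pd

  _≟ᵥ_ : DecidableEquality Vertex
  _≟ᵥ_ = ≡-dec Fin._≟_ Fin._≟_

  open import Data.List.Membership.DecPropositional _≟ᵥ_ using (_∈?_)

  row₀ : Fin height
  row₀ = fromℕ< {n = height} (≤-<-trans z≤n (m<m+n (3 * k) (s≤s z≤n)))

  column₀ : Fin (k + 2)
  column₀ = fromℕ< (≤-trans k≥1 (m≤m+n k 2))

  column₀-inner : toℕ column₀ < k
  column₀-inner = subst (_< k) (sym (Fin.toℕ-fromℕ< _)) k≥1

  CoveredIn : (ℕ → Set) → Vertex → Set
  CoveredIn R v = ∃ λ i → R (toℕ i) × v ∈ bag i

  coveredIn? : ∀ {R} → Decidable R → Decidable (CoveredIn R)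
  coveredIn? R? v = Fin.any? λ i → R? (toℕ i) ×-dec (v ∈? bag i)

  ColumnWithin ColumnMeets : (ℕ → Set) → Fin (k + 2) → Set
  ColumnWithin R x = ∀ y → CoveredIn R (x , y)
  ColumnMeets R x = ∃ λ y → CoveredIn R (x , y)

  SomeInnerColumnWithin : (ℕ → Set) → Set
  SomeInnerColumnWithin R = ∃ λ x → toℕ x < k × ColumnWithin R x

  someInnerColumnWithin? : ∀ {R} → Decidable R → Dec (SomeInnerColumnWithin R)
  someInnerColumnWithin? R? =
    Fin.any? λ x → (toℕ x <? k) ×-dec Fin.all? λ y → coveredIn? R? (x , y)

  meets-complement : ∀ {R R′ : ℕ → Set} → Decidable R → (∀ {t} → ¬ R t → R′ t) →
                     ∀ x → ¬ ColumnWithin R x → ColumnMeets R′ x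
  meets-complement R? ¬R⇒R′ x ¬within
    with y , ¬covered ← Fin.¬∀⟶∃¬ _ _ (λ y → coveredIn? R? (x , y)) ¬within
    with i , x,y∈i ← covers (x , y)
    = y , i , ¬R⇒R′ (λ Ri → ¬covered (i , Ri , x,y∈i)) , x,y∈i

  empty-range : ∀ {R : ℕ → Set} → (∀ i → ¬ R (toℕ i)) → ¬ SomeInnerColumnWithin R
  empty-range ¬R (_ , _ , within) = let i , Ri , _ = within row₀ in ¬R i Ri

  full-range : ∀ {R : ℕ → Set} → (∀ i → R (toℕ i)) → SomeInnerColumnWithin R
  full-range R =
    column₀ , column₀-inner , λ y → let i , v∈i = covers (column₀ , y) in i , R i , v∈i

  first-completed : ∃ λ (T : Fin m) → SomeInnerColumnWithin (_< suc (toℕ T)) ×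
                                      (∀ x → toℕ x < k → ColumnMeets (toℕ T ≤_) x)
  first-completed =
    let T , ¬within-T , within-T+1 =
          transition {P = λ t → SomeInnerColumnWithin (_< t)} (λ t → someInnerColumnWithin? (_<? t))
            (empty-range {_< 0} (λ _ ())) (full-range {_< m} Fin.toℕ<n)
    in T , within-T+1 ,
       λ x x<k → meets-complement (_<? toℕ T) ≮⇒≥ x (λ within → ¬within-T (x , x<k , within))

  last-started : ∃ λ (S : Fin m) → SomeInnerColumnWithin (toℕ S ≤_) ×
                                   (∀ x → toℕ x < k → ColumnMeets (_< suc (toℕ S)) x)
  last-started =
    let S , ¬¬within-S , ¬within-S+1 =
          transition {P = λ s → ¬ SomeInnerColumnWithin (s ≤_)}
            (λ s → ¬? (someInnerColumnWithin? (s ≤?_)))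
            (λ ¬within → ¬within (full-range {0 ≤_} (λ _ → z≤n)))
            (empty-range {m ≤_} (λ i → <⇒≱ (Fin.toℕ<n i)))
    in S , decidable-stable (someInnerColumnWithin? (toℕ S ≤?_)) ¬¬within-S ,
       λ x x<k → meets-complement (suc (toℕ S) ≤?_) ≰⇒> x
                   (λ within → ¬within-S+1 (x , x<k , within))

  module _ (T S : Fin m) (x₀ x₁ : Fin (k + 2))
           (x₀-before : ColumnWithin (_< suc (toℕ T)) x₀)
           (after-T : ∀ x → toℕ x < k → ColumnMeets (toℕ T ≤_) x)
           (x₁-after : ColumnWithin (toℕ S ≤_) x₁)
           (before-S : ∀ x → toℕ x < k → ColumnMeets (_< suc (toℕ S)) x)
           where

    inner-column-meets : ∀ {x p} → toℕ x < k → toℕ S ≤ toℕ p → toℕ p ≤ toℕ T →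
                         ∃ λ v → proj₁ v ≡ x × v ∈ bag p
    inner-column-meets {x} {p} x<k S≤p p≤T =
      let y  , i  , i<1+S , x,y∈i   = before-S x x<k
          y′ , i′ , T≤i′  , x,y′∈i′ = after-T x x<k
      in walk-meets-bag pd (lineWalk (column x<k) y y′) x,y∈i x,y′∈i′ p
           (≤-trans (≤-pred i<1+S) S≤p) (≤-trans p≤T T≤i′)

    pendant-edge-outside : ∀ {y p} → (pendant₀ , y) ∈ bag p → (pendant₁ , y) ∈ bag p →
                           toℕ S ≤ toℕ p → toℕ p ≤ toℕ T → ⊥
    pendant-edge-outside {y} {p} p₀∈p p₁∈p S≤p p≤T =
      <⇒≱ (≤-reflexive (+-comm 2 k))
          (≤-trans (surjectiveOn⇒≤length proj₁ every-column-meets) (narrow p))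
      where
      every-column-meets : ∀ x → ∃ λ v → proj₁ v ≡ x × v ∈ bag p
      every-column-meets x with innerOrPendant x
      ... | inner x<k = inner-column-meets x<k S≤p p≤T
      ... | pendant k≤x with pendant-cases k≤x
      ...   | inj₁ refl = _ , refl , p₀∈p
      ...   | inj₂ refl = _ , refl , p₁∈p

    row-meets : ∀ y → ∃ λ v → proj₂ v ≡ y × v ∈ bag S ++ bag T
    row-meets y
      with p , p₀∈p , p₁∈p ← edgeIn _ _ (pendant-edge y)
      with toℕ p <? toℕ S | toℕ T <? toℕ p
    ... | yes p<S | _ =
      let i , S≤i , x₁,y∈i = x₁-after y
          v , v-in-row , v∈S = walk-meets-bag pd (lineWalk (row y) pendant₀ x₁) p₀∈p x₁,y∈i S
                                 (<⇒≤ p<S) S≤i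
      in v , v-in-row , ∈-++⁺ˡ v∈S
    ... | no _ | yes T<p =
      let i , i<1+T , x₀,y∈i = x₀-before y
          v , v-in-row , v∈T = walk-meets-bag pd (lineWalk (row y) x₀ pendant₀) x₀,y∈i p₀∈p T
                                 (≤-pred i<1+T) (<⇒≤ T<p)
      in v , v-in-row , ∈-++⁺ʳ (bag S) v∈T
    ... | no p≮S | no T≮p =
      ⊥-elim (pendant-edge-outside p₀∈p p₁∈p (≮⇒≥ p≮S) (≮⇒≥ T≮p))

    too-many-rows : ⊥
    too-many-rows = <⇒≱ two-bags<height (begin
      height                           ≤⟨ surjectiveOn⇒≤length proj₂ row-meets ⟩
      length (bag S ++ bag T)          ≡⟨ length-++ (bag S) ⟩
      length (bag S) + length (bag T)  ≤⟨ +-mono-≤ (narrow S) (narrow T) ⟩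
      suc k + suc k                    ∎)
      where open ≤-Reasoning

  impossible : ⊥
  impossible =
    let T , (x₀ , _ , x₀-before) , after-T = first-completed
        S , (x₁ , _ , x₁-after)  , before-S = last-started
    in too-many-rows T S x₀ x₁ x₀-before after-T x₁-after before-S

width-lowerBound : ∀ k → 1 ≤ k → (pd : PathDecomposition (Gk k)) → k + 1 ≤ width pd
width-lowerBound k k≥1 pd with width pd ≤? k
... | yes width≤k = ⊥-elim (NarrowDecomposition.impossible k k≥1 pd narrow)
  where
  narrow : ∀ i → length (PathDecomposition.bag pd i) ≤ suc k
  narrow i = ≤-trans (length-bag≤1+width pd i) (s≤s width≤k)
... | no  width≰k = ≤-trans (≤-reflexive (+-comm k 1)) (≰⇒> width≰k)

lemma4 : ∀ (k : ℕ) → 1 ≤ k → HasPathwidth (Gk k) (k + 1)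
lemma4 k k≥1 =
  (sweep , ≤-antisym width-sweep≤ (width-lowerBound k k≥1 sweep)) , width-lowerBound k k≥1
  where open Sweep k
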